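{- Let $n\ge 1$ and let $t=(t_1,\dots,t_n)$ be a tuple of nonnegative integers; write $e_i$ for the $i$-th standard unit vector. With $g_i$ as defined in the context, put $g'_i(t)=g_i(t)/(t_1!t_2!\cdots t_n!)$. Then: (a) if $t_1=0$, then $g'_1(t)=P'(t)$ (in particular $g'_1(0,\dots,0)=1$) and $g'_i(t)=0$ for $i>1$; (b) if $t_1>0$, then $g'_1(t)=0$ and $g'_i(t)=0$ for every $i$ with $t_i=0$; (c) if $t_1>0$, $i>1$ and $t_i>0$, then $$g'_i(t)=P'(t-e_1-e_i)+P'(t-e_i)-g'_i(t-e_i);$$ (d) $P'(t_1,\dots,t_n)=\sum_{i=1}^n g'_i(t_1,\dots,t_n)$.
   Context: For pairwise disjoint finite sets $T_1,\dots,T_n$ with $|T_i|=t_i$, a generalized derangement (GD) is a permutation $\sigma$ of $\bigcup T_i$ with $\sigma(a)\notin T_i$ for all $i$ and $a\in T_i$; $P(t)$ is their number ($P(0,\dots,0)=1$). $P'(t_1,\dots,t_n)$ is the number of rearrangements $a_{1,1}\ldots a_{1,t_1}\ldots a_{n,1}\ldots a_{n,t_n}$ of the word $1^{t_1}2^{t_2}\cdots n^{t_n}$ with $a_{i,j}\neq i$ for all $i,j$; one has $P(t)=t_1!\cdots t_n!\,P'(t)$. The function $g_i$: if $t_1>0$, fix $a\in T_1$ and let $g_i(t)$ be the number of GDs $\sigma$ with $\sigma(a)\in T_i$; if $t_1=0$, let $g_1(t)=P(t)$ and $g_i(t)=0$ for $i>1$. -}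

module Defs where

open import Data.Nat using (ℕ; zero; suc; _*_; _!; NonZero)
open import Data.Nat.Properties using (m*n≢0)
open import Data.Nat.DivMod using (_/_)
open import Data.Fin using (Fin; zero; suc)
open import Data.Fin.Properties using (_≟_; all?)
open import Data.List using (List; []; _∷_; _++_; replicate; map; length; filter; concatMap; allFin)
import Data.List as L
open import Data.List.Relation.Unary.Any using (any?)
open import Data.Vec using (Vec; []; _∷_; toList; tabulate)
import Data.Vec as V
open import Data.Vec.Properties using (≡-dec)
open import Data.Product using (_×_)
open import Relation.Nullary using (¬?; _×-dec_; yes; no)
open import Relation.Binary.PropositionalEquality using (_≡_; _≢_)

-- The word 1^{t_1} 2^{t_2} ... n^{t_n}; letter i+1 of the paper is `i : Fin n`
-- (so `zero : Fin n` is the paper's index 1).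
word : ∀ {n} → Vec ℕ n → List (Fin n)
word [] = []
word (k ∷ t) = replicate k zero ++ map suc (word t)

-- The ground set ⋃ T_i is modelled as the positions Fin (size t) of the word;
-- position a lies in T_i iff the letter at a is i.
size : ∀ {n} → Vec ℕ n → ℕ
size t = length (word t)

block : ∀ {n} (t : Vec ℕ n) → Fin (size t) → Fin n
block t a = L.lookup (word t) a

vecs : ∀ {a} {A : Set a} → List A → (k : ℕ) → List (Vec A k)
vecs xs zero = [] ∷ []
vecs xs (suc k) = concatMap (λ x → map (x ∷_) (vecs xs k)) xs

-- permutations σ of Fin N, represented by the value vector (σ 0, …, σ (N-1)),
-- i.e. the maps Fin N → Fin N without repeated values (= bijections)
perms : (N : ℕ) → List (Vec (Fin N) N)
perms N = filter (λ v → unique? (toList v)) (vecs (allFin N) N)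
  where open import Data.List.Relation.Unary.Unique.DecPropositional (_≟_ {n = N}) using (unique?)

GDs : ∀ {n} (t : Vec ℕ n) → List (Vec (Fin (size t)) (size t))
GDs t = filter (λ σ → all? (λ a → ¬? (block t (V.lookup σ a) ≟ block t a))) (perms (size t))

P : ∀ {n} → Vec ℕ n → ℕ
P t = length (GDs t)

-- P'(t): number of rearrangements a of the word (w = letters read along some
-- permutation σ of the positions) with a_k ≠ (letter at position k)
P′ : ∀ {n} → Vec ℕ n → ℕ
P′ {n} t = length (filter
  (λ w → any? (λ σ → ≡-dec _≟_ w (tabulate (λ k → block t (V.lookup σ k)))) (perms (size t))
         ×-dec all? (λ k → ¬? (V.lookup w k ≟ block t k)))
  (vecs (allFin n) (size t)))

-- g_i(t). If t_1 > 0, the fixed element a ∈ T_1 is position 0 of the word.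
g : ∀ {m} → Fin (suc m) → Vec ℕ (suc m) → ℕ
g zero    (zero ∷ t)  = P (zero ∷ t)
g (suc i) (zero ∷ t)  = 0
g i (suc k ∷ t) =
  length (filter (λ σ → block (suc k ∷ t) (V.lookup σ zero) ≟ i) (GDs (suc k ∷ t)))

prodFact : ∀ {n} → Vec ℕ n → ℕ
prodFact [] = 1
prodFact (k ∷ t) = k ! * prodFact t

fact-nz : ∀ k → NonZero (k !)
fact-nz zero = _
fact-nz (suc k) = m*n≢0 (suc k) (k !) {{_}} {{fact-nz k}}

prodFact-nz : ∀ {n} (t : Vec ℕ n) → NonZero (prodFact t)
prodFact-nz [] = _
prodFact-nz (k ∷ t) = m*n≢0 (k !) (prodFact t) {{fact-nz k}} {{prodFact-nz t}}

g′ : ∀ {m} → Fin (suc m) → Vec ℕ (suc m) → ℕ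
g′ i t = _/_ (g i t) (prodFact t) {{prodFact-nz t}}

_-e_ : ∀ {n} → Vec ℕ n → Fin n → Vec ℕ n
t -e i = V.updateAt t i Data.Nat.pred

module Submission where

-- The proof counts everything through one recursion.  For a list bs of
-- letters from Fin n and a vector c of multiplicities, W bs c is defined by
--   W [] c = [c = 0],   W (b ∷ bs) c = Σ_j [j ≠ b] [c_j > 0] · W bs (c - e_j),
-- i.e. by choosing the first letter of a word with letter counts c that
-- differs from bs at every position.  We prove:
--   * words≡W / P′≡W: W bs c counts those words, and a word is a
--     rearrangement of 1^{t₁}⋯n^{tₙ} exactly when its letter counts are t,
--     so P′(t) = W (word t) t;
--   * placements / P≡W / g≡W: the injective maps deranging bs are counted by
--     c₁!⋯cₙ! · W bs c (choose the image of the first position and recurse),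
--     so P(t) = t₁!⋯tₙ! · P′(t), and for t₁ > 0, g_i(t) is t₁!⋯tₙ! times the
--     summand j = i of the recursion for W (word t) t;
--   * W-perm: W bs c only depends on the multiset of letters of bs (swapping
--     the first two letters swaps two summations).
-- Dividing by t₁!⋯tₙ!, parts (a), (b), (d) are read off the recursion, and (c)
-- compares the recursions for W at t - e_i whose first letters are i and 1.

open import Defs
open import Data.Nat using (ℕ; suc; _+_; _∸_; _<_)
open import Data.Fin using (Fin; zero)
open import Data.Vec using (Vec; head; lookup; replicate; tabulate; sum)
open import Data.Product using (_×_)
open import Relation.Binary.PropositionalEquality using (_≡_; _≢_)

open import Level using (Level)
open import Data.Nat using (zero; _*_; _≤_; z≤n; s≤s; _!)
open import Data.Nat.Properties
open import Data.Nat.DivMod using (_/_; m*n/n≡m)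
open import Data.Nat.Tactic.RingSolver using (solve-∀)
open import Data.Fin using (suc)
open import Data.Fin.Properties using (all?) renaming (_≟_ to _≟ᶠ_; suc-injective to fin-suc-injective)
open import Data.List using (List; []; _∷_; _++_; map; length; filter; concatMap; allFin)
import Data.List as L
import Data.List.Properties as LP
open import Data.List.Membership.Propositional using (_∈_; find; lose)
open import Data.List.Membership.Propositional.Properties
  using (∈-map⁺; ∈-++⁺ˡ; ∈-++⁺ʳ; ∈-filter⁺; ∈-filter⁻; ∈-allFin)
open import Data.List.Relation.Unary.Any using (Any; here; there)
open import Data.List.Relation.Unary.All as All using (All; []; _∷_)
open import Data.List.Relation.Unary.AllPairs using ([]; _∷_)
import Data.List.Relation.Unary.AllPairs as AllPairs
open import Data.List.Relation.Unary.Unique.Propositional using (Unique)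
import Data.List.Relation.Unary.Unique.Propositional.Properties as UP
import Data.List.Relation.Unary.Unique.DecPropositional as UniqueDec
open import Data.List.Relation.Binary.Permutation.Propositional using (_↭_; prep; swap)
  renaming (refl to ↭-refl; trans to ↭-trans)
import Data.List.Relation.Binary.Permutation.Propositional.Properties as Perm
open import Data.Vec using ([]; _∷_; toList)
import Data.Vec.Properties as VP
open import Data.Product using (_,_; proj₁; proj₂; Σ-syntax; ∃-syntax)
open import Relation.Nullary using (Dec; yes; no; ¬_; ¬?; _×-dec_)
open import Relation.Unary using (Pred; Decidable)
open import Relation.Binary.PropositionalEquality using (refl; sym; trans; cong; cong₂; subst; module ≡-Reasoning)
open import Function using (_∘_; id)
open import Data.Empty using (⊥-elim)
open import Algebra.Properties.Semiring.Sum +-*-semiring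
  using (sum-syntax; sum-cong-≗; ∑-distrib-+; ∑-comm; sum-replicate-zero; *-distribˡ-sum)

private variable
  a p q ℓ : Level
  A B : Set a
  n k m N : ℕ

when : {P : Set ℓ} → Dec P → ℕ → ℕ
when (yes _) n = n
when (no _)  n = 0

unless : {P : Set ℓ} → Dec P → ℕ → ℕ
unless (yes _) n = 0
unless (no _)  n = n

module _ {P : Set ℓ} where

  when-yes : (d : Dec P) → P → when d n ≡ n
  when-yes (yes _) _  = refl
  when-yes (no ¬p) p = ⊥-elim (¬p p)

  when-no : (d : Dec P) → ¬ P → when d n ≡ 0
  when-no (yes p) ¬p = ⊥-elim (¬p p)
  when-no (no _)  _  = refl

  when-0 : (d : Dec P) → when d 0 ≡ 0
  when-0 (yes _) = refl
  when-0 (no _)  = refl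

  when-1* : (d : Dec P) → when d 1 * n ≡ when d n
  when-1* (yes _) = *-identityˡ _
  when-1* (no _)  = refl

  unless-*ʳ : (d : Dec P) → unless d m * n ≡ unless d (m * n)
  unless-*ʳ (yes _) = refl
  unless-*ʳ (no _)  = refl

  unless-0 : (d : Dec P) → unless d 0 ≡ 0
  unless-0 (yes _) = refl
  unless-0 (no _)  = refl

  when-split : (d : Dec P) → when d n + unless d n ≡ n
  when-split (yes _) = +-identityʳ _
  when-split (no _)  = refl

  when-× : {ℓ′ : Level} {Q : Set ℓ′} (d : Dec P) (e : Dec Q) → when (d ×-dec e) n ≡ when d (when e n)
  when-× (yes _) (yes _) = refl
  when-× (yes _) (no _)  = refl
  when-× (no _)  (yes _) = refl
  when-× (no _)  (no _)  = refl

when-⇔ : {ℓ′ : Level} {P : Set ℓ} {Q : Set ℓ′} (d : Dec P) (e : Dec Q) → (P → Q) → (Q → P) → when d n ≡ when e n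
when-⇔ (yes _) (yes _) _ _ = refl
when-⇔ (yes p) (no ¬q) f _ = ⊥-elim (¬q (f p))
when-⇔ (no ¬p) (yes q) _ g = ⊥-elim (¬p (g q))
when-⇔ (no _)  (no _)  _ _ = refl

# : {P : Pred A p} → Decidable P → List A → ℕ
# P? xs = length (filter P? xs)

#-∷ : {P : Pred A p} (P? : Decidable P) → ∀ x xs → # P? (x ∷ xs) ≡ when (P? x) 1 + # P? xs
#-∷ P? x xs with P? x
... | yes _ = refl
... | no _  = refl

module _ {P : Pred A p} (P? : Decidable P) where

  #-++ : ∀ xs ys → # P? (xs ++ ys) ≡ # P? xs + # P? ys
  #-++ xs ys = trans (cong length (LP.filter-++ P? xs ys)) (LP.length-++ (filter P? xs))

  #-map : (f : B → A) → ∀ xs → # P? (map f xs) ≡ # (P? ∘ f) xs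
  #-map f []       = refl
  #-map f (x ∷ xs) = trans (#-∷ P? (f x) (map f xs))
    (trans (cong (when (P? (f x)) 1 +_) (#-map f xs)) (sym (#-∷ (P? ∘ f) x xs)))

  #-none : (∀ x → ¬ P x) → ∀ xs → # P? xs ≡ 0
  #-none ¬P xs = cong length (LP.filter-none P? (All.universal ¬P xs))

#-≐ : {P : Pred A p} {Q : Pred A q} (P? : Decidable P) (Q? : Decidable Q) →
      (∀ {x} → P x → Q x) → (∀ {x} → Q x → P x) → ∀ xs → # P? xs ≡ # Q? xs
#-≐ P? Q? f g xs = cong length (LP.filter-≐ P? Q? (f , g) xs)

filter-filter : {P : Pred A p} {Q : Pred A q} (P? : Decidable P) (Q? : Decidable Q) →
                ∀ xs → filter P? (filter Q? xs) ≡ filter (λ x → P? x ×-dec Q? x) xs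
filter-filter P? Q? [] = refl
filter-filter P? Q? (x ∷ xs) with Q? x
... | yes _ with P? x
...   | yes _ = cong (x ∷_) (filter-filter P? Q? xs)
...   | no _  = filter-filter P? Q? xs
filter-filter P? Q? (x ∷ xs) | no _ with P? x
...   | yes _ = filter-filter P? Q? xs
...   | no _  = filter-filter P? Q? xs

#-const : {R : Set ℓ} {P : Pred A p} (d : Dec R) (P? : Decidable P) →
          ∀ xs → # (λ x → d ×-dec P? x) xs ≡ when d (# P? xs)
#-const (yes r) P? xs = #-≐ _ P? proj₂ (r ,_) xs
#-const (no ¬r) P? xs = #-none _ (λ _ → ¬r ∘ proj₁) xs

#-pos : {P : Pred A p} (P? : Decidable P) → ∀ xs → 0 < # P? xs → ∃[ x ] x ∈ xs × P x
#-pos P? (x ∷ xs) pos with P? x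
... | yes px = x , here refl , px
... | no _ with #-pos P? xs pos
...   | y , y∈xs , py = y , there y∈xs , py

#-replicate : {P : Pred A p} (P? : Decidable P) (x : A) (k : ℕ) → # P? (L.replicate k x) ≡ when (P? x) k
#-replicate P? x zero = sym (when-0 (P? x))
#-replicate P? x (suc k) with P? x | #-replicate P? x k
... | yes _ | ih = cong suc ih
... | no _  | ih = ih

∑-zero : (f : Fin n → ℕ) → (∀ j → f j ≡ 0) → ∑[ j < n ] f j ≡ 0
∑-zero {n} f f≡0 = trans (sum-cong-≗ {n} f≡0) (sum-replicate-zero n)

∑-δ : (a : Fin n) (h : Fin n → ℕ) → ∑[ j < n ] when (a ≟ᶠ j) (h j) ≡ h a
∑-δ {suc n} zero h =
  trans (cong (h zero +_) (∑-zero (λ j → when (zero ≟ᶠ suc j) (h (suc j))) (λ _ → refl))) (+-identityʳ (h zero))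
∑-δ {suc n} (suc a) h = begin
  ∑[ j < n ] when (suc a ≟ᶠ suc j) (h (suc j))
    ≡⟨ sum-cong-≗ {n} (λ j → when-⇔ (suc a ≟ᶠ suc j) (a ≟ᶠ j) fin-suc-injective (cong suc)) ⟩
  ∑[ j < n ] when (a ≟ᶠ j) (h (suc j))
    ≡⟨ ∑-δ a (h ∘ suc) ⟩
  h (suc a) ∎
  where open ≡-Reasoning

∑-except : (a : Fin n) (h : Fin n → ℕ) →
           ∑[ j < n ] unless (a ≟ᶠ j) (h j) + h a ≡ ∑[ j < n ] h j
∑-except {n} a h = begin
  ∑[ j < n ] unless (a ≟ᶠ j) (h j) + h a
    ≡⟨ +-comm _ (h a) ⟩
  h a + ∑[ j < n ] unless (a ≟ᶠ j) (h j)
    ≡⟨ cong (_+ ∑[ j < n ] unless (a ≟ᶠ j) (h j)) (sym (∑-δ a h)) ⟩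
  ∑[ j < n ] when (a ≟ᶠ j) (h j) + ∑[ j < n ] unless (a ≟ᶠ j) (h j)
    ≡⟨ sym (∑-distrib-+ (λ j → when (a ≟ᶠ j) (h j)) (λ j → unless (a ≟ᶠ j) (h j))) ⟩
  ∑[ j < n ] (when (a ≟ᶠ j) (h j) + unless (a ≟ᶠ j) (h j))
    ≡⟨ sum-cong-≗ {n} (λ j → when-split (a ≟ᶠ j)) ⟩
  ∑[ j < n ] h j ∎
  where open ≡-Reasoning

sum-tabulate : (f : Fin n → ℕ) → sum (tabulate f) ≡ ∑[ j < n ] f j
sum-tabulate {zero}  f = refl
sum-tabulate {suc n} f = cong (f zero +_) (sum-tabulate (f ∘ suc))

sumOver : List A → (A → ℕ) → ℕ
sumOver []       f = 0
sumOver (x ∷ xs) f = f x + sumOver xs f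

sumOver-cong : (xs : List A) {f g : A → ℕ} → (∀ {x} → x ∈ xs → f x ≡ g x) →
               sumOver xs f ≡ sumOver xs g
sumOver-cong []       f≡g = refl
sumOver-cong (x ∷ xs) f≡g = cong₂ _+_ (f≡g (here refl)) (sumOver-cong xs (f≡g ∘ there))

sumOver-filter : {R : Pred A p} (R? : Decidable R) → ∀ xs (f : A → ℕ) →
                 sumOver (filter R? xs) f ≡ sumOver xs (λ x → when (R? x) (f x))
sumOver-filter R? []       f = refl
sumOver-filter R? (x ∷ xs) f with R? x
... | yes _ = cong (f x +_) (sumOver-filter R? xs f)
... | no _  = sumOver-filter R? xs f

sumOver-allFin : (f : Fin n → ℕ) → sumOver (allFin n) f ≡ ∑[ j < n ] f j
sumOver-allFin f = go f id
  where
  go : (f : A → ℕ) (g : Fin m → A) → sumOver (L.tabulate g) f ≡ ∑[ j < m ] f (g j)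
  go {m = zero}  f g = refl
  go {m = suc m} f g = cong (f (g zero) +_) (go f (g ∘ suc))

cnt : (A → Fin n) → List A → Fin n → ℕ
cnt bl xs j = # (λ x → bl x ≟ᶠ j) xs

sumOver-block : (bl : A → Fin n) (j : Fin n) (K : ℕ) →
                ∀ xs → sumOver xs (λ x → when (bl x ≟ᶠ j) K) ≡ cnt bl xs j * K
sumOver-block bl j K []       = refl
sumOver-block bl j K (x ∷ xs) = begin
  when (bl x ≟ᶠ j) K + sumOver xs (λ x → when (bl x ≟ᶠ j) K)
    ≡⟨ cong₂ _+_ (sym (when-1* (bl x ≟ᶠ j))) (sumOver-block bl j K xs) ⟩
  when (bl x ≟ᶠ j) 1 * K + cnt bl xs j * K
    ≡⟨ sym (*-distribʳ-+ K (when (bl x ≟ᶠ j) 1) (cnt bl xs j)) ⟩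
  (when (bl x ≟ᶠ j) 1 + cnt bl xs j) * K
    ≡⟨ cong (_* K) (sym (#-∷ (λ x → bl x ≟ᶠ j) x xs)) ⟩
  cnt bl (x ∷ xs) j * K ∎
  where open ≡-Reasoning

#-by-block : {P : Pred A p} (P? : Decidable P) (bl : A → Fin n) →
             ∀ xs → # P? xs ≡ ∑[ j < n ] # (λ x → (bl x ≟ᶠ j) ×-dec P? x) xs
#-by-block {n = n} P? bl [] = sym (∑-zero {n} (λ _ → 0) (λ _ → refl))
#-by-block {A = A} {n = n} P? bl (x ∷ xs) = begin
  # P? (x ∷ xs)
    ≡⟨ #-∷ P? x xs ⟩
  when (P? x) 1 + # P? xs
    ≡⟨ cong₂ _+_ (sym (∑-δ (bl x) (λ _ → when (P? x) 1))) (#-by-block P? bl xs) ⟩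
  ∑[ j < n ] when (bl x ≟ᶠ j) (when (P? x) 1) + ∑[ j < n ] #[ j ] xs
    ≡⟨ sym (∑-distrib-+ (λ j → when (bl x ≟ᶠ j) (when (P? x) 1)) (λ j → #[ j ] xs)) ⟩
  ∑[ j < n ] (when (bl x ≟ᶠ j) (when (P? x) 1) + #[ j ] xs)
    ≡⟨ sum-cong-≗ {n} (λ j → trans (cong (_+ #[ j ] xs) (sym (when-× (bl x ≟ᶠ j) (P? x))))
                                   (sym (#-∷ (λ y → (bl y ≟ᶠ j) ×-dec P? y) x xs))) ⟩
  ∑[ j < n ] #[ j ] (x ∷ xs) ∎
  where
  open ≡-Reasoning
  #[_] : Fin n → List A → ℕ
  #[ j ] = # (λ y → (bl y ≟ᶠ j) ×-dec P? y)

#-vecs-zero : {P : Pred (Vec A 0) p} (P? : Decidable P) (xs : List A) →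
              # P? (vecs xs 0) ≡ when (P? []) 1
#-vecs-zero P? xs = trans (#-∷ P? [] []) (+-identityʳ _)

#-vecs-suc : {P : Pred (Vec A (suc k)) p} (P? : Decidable P) (xs : List A) →
             # P? (vecs xs (suc k)) ≡ sumOver xs (λ x → # (λ v → P? (x ∷ v)) (vecs xs k))
#-vecs-suc {k = k} P? xs = go xs
  where
  go : ∀ ys → # P? (concatMap (λ x → map (x ∷_) (vecs xs k)) ys)
            ≡ sumOver ys (λ x → # (λ v → P? (x ∷ v)) (vecs xs k))
  go []       = refl
  go (y ∷ ys) = trans (#-++ P? (map (y ∷_) (vecs xs k)) _)
                      (cong₂ _+_ (#-map P? (y ∷_) (vecs xs k)) (go ys))

#-vecs-restrict : {R : Pred A p} (R? : Decidable R) (xs : List A) →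
                  ∀ k {Q : Pred (Vec A k) q} (Q? : Decidable Q) →
                  # (λ v → All.all? R? (toList v) ×-dec Q? v) (vecs xs k) ≡ # Q? (vecs (filter R? xs) k)
#-vecs-restrict R? xs zero Q? = begin
  # (λ v → All.all? R? (toList v) ×-dec Q? v) (vecs xs 0)
    ≡⟨ #-vecs-zero (λ v → All.all? R? (toList v) ×-dec Q? v) xs ⟩
  when (All.all? R? [] ×-dec Q? []) 1
    ≡⟨ when-⇔ (All.all? R? [] ×-dec Q? []) (Q? []) proj₂ ([] ,_) ⟩
  when (Q? []) 1
    ≡⟨ sym (#-vecs-zero Q? (filter R? xs)) ⟩
  # Q? (vecs (filter R? xs) 0) ∎
  where open ≡-Reasoning
#-vecs-restrict R? xs (suc k) Q? = begin
  # (λ v → All.all? R? (toList v) ×-dec Q? v) (vecs xs (suc k))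
    ≡⟨ #-vecs-suc _ xs ⟩
  sumOver xs (λ x → # (λ v → All.all? R? (x ∷ toList v) ×-dec Q? (x ∷ v)) (vecs xs k))
    ≡⟨ sumOver-cong xs (λ {x} _ → first x) ⟩
  sumOver xs (λ x → when (R? x) (# (λ v → Q? (x ∷ v)) (vecs (filter R? xs) k)))
    ≡⟨ sym (sumOver-filter R? xs _) ⟩
  sumOver (filter R? xs) (λ x → # (λ v → Q? (x ∷ v)) (vecs (filter R? xs) k))
    ≡⟨ sym (#-vecs-suc Q? (filter R? xs)) ⟩
  # Q? (vecs (filter R? xs) (suc k)) ∎
  where
  open ≡-Reasoning
  first : ∀ x → # (λ v → All.all? R? (x ∷ toList v) ×-dec Q? (x ∷ v)) (vecs xs k)
              ≡ when (R? x) (# (λ v → Q? (x ∷ v)) (vecs (filter R? xs) k))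
  first x with R? x
  ... | yes r = trans (#-≐ _ (λ v → All.all? R? (toList v) ×-dec Q? (x ∷ v))
                           (λ (rs , q) → All.tail rs , q) (λ (rs , q) → (r ∷ rs) , q) (vecs xs k))
                      (#-vecs-restrict R? xs k (λ v → Q? (x ∷ v)))
  ... | no ¬r = #-none _ (λ _ → ¬r ∘ All.head ∘ proj₁) (vecs xs k)

vecs-complete : (xs : List A) (v : Vec A k) → All (_∈ xs) (toList v) → v ∈ vecs xs k
vecs-complete xs [] _ = here refl
vecs-complete {k = suc k} xs (x ∷ v) (x∈xs ∷ v⊆xs) = go xs x∈xs
  where
  go : ∀ ys → x ∈ ys → (x ∷ v) ∈ concatMap (λ y → map (y ∷_) (vecs xs k)) ys
  go (y ∷ ys) (here refl) = ∈-++⁺ˡ (∈-map⁺ (x ∷_) (vecs-complete xs v v⊆xs))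
  go (y ∷ ys) (there x∈ys) = ∈-++⁺ʳ (map (y ∷_) (vecs xs k)) (go ys x∈ys)

remove : Fin N → List (Fin N) → List (Fin N)
remove x = filter (λ y → ¬? (x ≟ᶠ y))

module _ {x : Fin N} where

  cnt-remove : (bl : Fin N → Fin n) (j : Fin n) → ∀ {xs} → Unique xs → x ∈ xs →
               cnt bl (remove x xs) j + when (bl x ≟ᶠ j) 1 ≡ cnt bl xs j
  cnt-remove bl j {x ∷ ys} (x∉ys ∷ _) (here refl)
    rewrite LP.filter-reject (λ y → ¬? (x ≟ᶠ y)) {x} {ys} (λ x≢x → x≢x refl)
          | LP.filter-all (λ y → ¬? (x ≟ᶠ y)) x∉ys =
    trans (+-comm (cnt bl ys j) _) (sym (#-∷ (λ y → bl y ≟ᶠ j) x ys))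
  cnt-remove bl j {y ∷ ys} (y∉ys ∷ ys!) (there x∈ys)
    rewrite LP.filter-accept (λ z → ¬? (x ≟ᶠ z)) {y} {ys} (λ x≡y → All.lookup y∉ys x∈ys (sym x≡y)) =
    begin
      cnt bl (y ∷ remove x ys) j + when (bl x ≟ᶠ j) 1
        ≡⟨ cong (_+ when (bl x ≟ᶠ j) 1) (#-∷ (λ z → bl z ≟ᶠ j) y (remove x ys)) ⟩
      when (bl y ≟ᶠ j) 1 + cnt bl (remove x ys) j + when (bl x ≟ᶠ j) 1
        ≡⟨ +-assoc (when (bl y ≟ᶠ j) 1) _ _ ⟩
      when (bl y ≟ᶠ j) 1 + (cnt bl (remove x ys) j + when (bl x ≟ᶠ j) 1)
        ≡⟨ cong (when (bl y ≟ᶠ j) 1 +_) (cnt-remove bl j ys! x∈ys) ⟩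
      when (bl y ≟ᶠ j) 1 + cnt bl ys j
        ≡⟨ sym (#-∷ (λ z → bl z ≟ᶠ j) y ys) ⟩
      cnt bl (y ∷ ys) j ∎
    where open ≡-Reasoning

  length-remove : ∀ {xs} → Unique xs → x ∈ xs → suc (length (remove x xs)) ≡ length xs
  length-remove {x ∷ ys} (x∉ys ∷ _) (here refl)
    rewrite LP.filter-reject (λ y → ¬? (x ≟ᶠ y)) {x} {ys} (λ x≢x → x≢x refl)
          | LP.filter-all (λ y → ¬? (x ≟ᶠ y)) x∉ys = refl
  length-remove {y ∷ ys} (y∉ys ∷ ys!) (there x∈ys)
    rewrite LP.filter-accept (λ z → ¬? (x ≟ᶠ z)) {y} {ys} (λ x≡y → All.lookup y∉ys x∈ys (sym x≡y)) =
    cong suc (length-remove ys! x∈ys)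

  remove-unique : ∀ {xs} → Unique xs → Unique (remove x xs)
  remove-unique = UP.filter⁺ (λ y → ¬? (x ≟ᶠ y))

  ⊆-remove : ∀ {xs} (l : List (Fin N)) → All (_∈ xs) l → All (x ≢_) l → All (_∈ remove x xs) l
  ⊆-remove []      []                []                = []
  ⊆-remove (y ∷ l) (y∈xs ∷ l⊆xs) (x≢y ∷ x∉l) =
    ∈-filter⁺ (λ z → ¬? (x ≟ᶠ z)) y∈xs x≢y ∷ ⊆-remove l l⊆xs x∉l

cnt-full : (bl : Fin N → Fin n) (j : Fin n) → ∀ {xs} (l : List (Fin N)) →
           Unique l → All (_∈ xs) l → Unique xs → length l ≡ length xs → cnt bl l j ≡ cnt bl xs j
cnt-full bl j {[]}    []      _           _              _   _     = refl
cnt-full bl j {xs}    (y ∷ l) (y∉l ∷ l!) (y∈xs ∷ l⊆xs) xs! |l|≡|xs| = begin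
  cnt bl (y ∷ l) j                          ≡⟨ #-∷ (λ z → bl z ≟ᶠ j) y l ⟩
  when (bl y ≟ᶠ j) 1 + cnt bl l j            ≡⟨ cong (when (bl y ≟ᶠ j) 1 +_) (cnt-full bl j l l! (⊆-remove l l⊆xs y∉l) (remove-unique xs!) |l|) ⟩
  when (bl y ≟ᶠ j) 1 + cnt bl (remove y xs) j ≡⟨ +-comm (when (bl y ≟ᶠ j) 1) _ ⟩
  cnt bl (remove y xs) j + when (bl y ≟ᶠ j) 1 ≡⟨ cnt-remove bl j xs! y∈xs ⟩
  cnt bl xs j                                ∎
  where
  open ≡-Reasoning
  |l| : length l ≡ length (remove y xs)
  |l| = suc-injective (trans |l|≡|xs| (sym (length-remove xs! y∈xs)))

lookup-−e : (c : Vec ℕ n) (j i : Fin n) → lookup (c -e j) i ≡ lookup c i ∸ when (j ≟ᶠ i) 1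
lookup-−e (x ∷ c) zero    zero    = refl
lookup-−e (x ∷ c) zero    (suc i) = refl
lookup-−e (x ∷ c) (suc j) zero    = refl
lookup-−e (x ∷ c) (suc j) (suc i) =
  trans (lookup-−e c j i) (cong (lookup c i ∸_) (when-⇔ (j ≟ᶠ i) (suc j ≟ᶠ suc i) (cong suc) fin-suc-injective))

lookup-−e-other : (c : Vec ℕ n) {j i : Fin n} → j ≢ i → lookup (c -e j) i ≡ lookup c i
lookup-−e-other c {j} {i} j≢i = trans (lookup-−e c j i) (cong (lookup c i ∸_) (when-no (j ≟ᶠ i) j≢i))

−e-comm : (c : Vec ℕ n) (j k : Fin n) → (c -e j) -e k ≡ (c -e k) -e j
−e-comm (x ∷ c) zero    zero    = refl
−e-comm (x ∷ c) zero    (suc k) = refl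
−e-comm (x ∷ c) (suc j) zero    = refl
−e-comm (x ∷ c) (suc j) (suc k) = cong (x ∷_) (−e-comm c j k)

prodFact-−e : (c : Vec ℕ n) (j : Fin n) → lookup c j ≡ suc m → prodFact c ≡ suc m * prodFact (c -e j)
prodFact-−e {m = m} (x ∷ c) zero refl = *-assoc (suc m) (m !) (prodFact c)
prodFact-−e {m = m} (x ∷ c) (suc j) cⱼ≡1+m = begin
  x ! * prodFact c                   ≡⟨ cong (x ! *_) (prodFact-−e c j cⱼ≡1+m) ⟩
  x ! * (suc m * prodFact (c -e j))  ≡⟨ x*[y*z]≡y*[x*z] (x !) (suc m) _ ⟩
  suc m * (x ! * prodFact (c -e j))  ∎
  where
  open ≡-Reasoning
  x*[y*z]≡y*[x*z] : ∀ a b d → a * (b * d) ≡ b * (a * d)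
  x*[y*z]≡y*[x*z] = solve-∀

prodFact-zeros : (c : Vec ℕ n) → (∀ j → lookup c j ≡ 0) → prodFact c ≡ 1
prodFact-zeros []      _    = refl
prodFact-zeros (x ∷ c) c≡0 rewrite c≡0 zero = cong (1 *_) (prodFact-zeros c (c≡0 ∘ suc))

minus-e : (c : Vec ℕ n) (j : Fin n) {u : Fin n → ℕ} →
          (∀ i → when (j ≟ᶠ i) 1 + u i ≡ lookup c i) → ∀ i → u i ≡ lookup (c -e j) i
minus-e c j {u} u+e≡c i = begin
  u i                                  ≡⟨ m+n∸m≡n (when (j ≟ᶠ i) 1) (u i) ⟨
  when (j ≟ᶠ i) 1 + u i ∸ when (j ≟ᶠ i) 1 ≡⟨ cong (_∸ when (j ≟ᶠ i) 1) (u+e≡c i) ⟩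
  lookup c i ∸ when (j ≟ᶠ i) 1         ≡⟨ lookup-−e c j i ⟨
  lookup (c -e j) i                    ∎
  where open ≡-Reasoning

plus-e : (c : Vec ℕ n) (j : Fin n) → 0 < lookup c j → {u : Fin n → ℕ} →
         (∀ i → u i ≡ lookup (c -e j) i) → ∀ i → when (j ≟ᶠ i) 1 + u i ≡ lookup c i
plus-e c j cⱼ>0 {u} u≡c-e i = begin
  when (j ≟ᶠ i) 1 + u i                          ≡⟨ cong (when (j ≟ᶠ i) 1 +_) (trans (u≡c-e i) (lookup-−e c j i)) ⟩
  when (j ≟ᶠ i) 1 + (lookup c i ∸ when (j ≟ᶠ i) 1) ≡⟨ m+[n∸m]≡n e≤c ⟩
  lookup c i                                     ∎
  where
  open ≡-Reasoning
  e≤c : when (j ≟ᶠ i) 1 ≤ lookup c i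
  e≤c with j ≟ᶠ i
  ... | yes refl = cⱼ>0
  ... | no _     = z≤n

sgn : ℕ → ℕ
sgn zero    = 0
sgn (suc _) = 1

-- weight b c j is 1 if letter j may be put at a position whose own letter is
-- b when the letter counts still to be used are c (that is j ≠ b and c_j > 0),
-- and 0 otherwise.
weight : Fin n → Vec ℕ n → Fin n → ℕ
weight b c j = unless (b ≟ᶠ j) (sgn (lookup c j))

-- W bs c is the number of words with letter counts c that differ from bs at
-- every position (this is `words≡W` below), computed by choosing the first letter.
W : List (Fin n) → Vec ℕ n → ℕ
W     []       c = when (all? (λ j → lookup c j ≟ 0)) 1
W {n} (b ∷ bs) c = ∑[ j < n ] (weight b c j * W bs (c -e j))

sgn-swap : (c : Vec ℕ n) (j k : Fin n) →
           sgn (lookup c j) * sgn (lookup (c -e j) k) ≡ sgn (lookup c k) * sgn (lookup (c -e k) j)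
sgn-swap c j k with j ≟ᶠ k
... | yes refl = refl
... | no j≢k rewrite lookup-−e-other c j≢k | lookup-−e-other c (j≢k ∘ sym) =
  *-comm (sgn (lookup c j)) (sgn (lookup c k))

weight-swap : (x y : Fin n) (c : Vec ℕ n) (j k : Fin n) →
              weight x c j * weight y (c -e j) k ≡ weight y c k * weight x (c -e k) j
weight-swap x y c j k with x ≟ᶠ j | y ≟ᶠ k
... | yes _ | y≟k   = sym (*-zeroʳ (unless y≟k (sgn (lookup c k))))
... | no _  | yes _ = *-zeroʳ (sgn (lookup c j))
... | no _  | no _  = sgn-swap c j k

-- W bs c depends only on the multiset of letters of bs: swapping the first two
-- letters swaps the order of two summations.
W-perm : {bs bs′ : List (Fin n)} → bs ↭ bs′ → ∀ c → W bs c ≡ W bs′ c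
W-perm ↭-refl c = refl
W-perm {n} (prep b p) c = sum-cong-≗ {n} (λ j → cong (weight b c j *_) (W-perm p (c -e j)))
W-perm (↭-trans p q) c = trans (W-perm p c) (W-perm q c)
W-perm {n} {x ∷ y ∷ bs} {_ ∷ _ ∷ bs′} (swap x y p) c = begin
  ∑[ j < n ] (weight x c j * ∑[ k < n ] (weight y (c -e j) k * W bs ((c -e j) -e k)))
    ≡⟨ sum-cong-≗ {n} (λ j → *-distribˡ-sum (weight x c j) (λ k → weight y (c -e j) k * W bs ((c -e j) -e k))) ⟩
  ∑[ j < n ] ∑[ k < n ] (weight x c j * (weight y (c -e j) k * W bs ((c -e j) -e k)))
    ≡⟨ sum-cong-≗ {n} (λ j → sum-cong-≗ {n} (λ k → swap-term j k)) ⟩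
  ∑[ j < n ] ∑[ k < n ] (weight y c k * (weight x (c -e k) j * W bs′ ((c -e k) -e j)))
    ≡⟨ ∑-comm (λ j k → weight y c k * (weight x (c -e k) j * W bs′ ((c -e k) -e j))) ⟩
  ∑[ k < n ] ∑[ j < n ] (weight y c k * (weight x (c -e k) j * W bs′ ((c -e k) -e j)))
    ≡⟨ sum-cong-≗ {n} (λ k → sym (*-distribˡ-sum (weight y c k) (λ j → weight x (c -e k) j * W bs′ ((c -e k) -e j)))) ⟩
  ∑[ k < n ] (weight y c k * ∑[ j < n ] (weight x (c -e k) j * W bs′ ((c -e k) -e j))) ∎
  where
  open ≡-Reasoning
  swap-term : ∀ j k → weight x c j * (weight y (c -e j) k * W bs ((c -e j) -e k))
                    ≡ weight y c k * (weight x (c -e k) j * W bs′ ((c -e k) -e j))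
  swap-term j k = begin
    weight x c j * (weight y (c -e j) k * W bs ((c -e j) -e k))
      ≡⟨ *-assoc (weight x c j) _ _ ⟨
    weight x c j * weight y (c -e j) k * W bs ((c -e j) -e k)
      ≡⟨ cong₂ _*_ (weight-swap x y c j k) (trans (cong (W bs) (−e-comm c j k)) (W-perm p _)) ⟩
    weight y c k * weight x (c -e k) j * W bs′ ((c -e k) -e j)
      ≡⟨ *-assoc (weight y c k) _ _ ⟩
    weight y c k * (weight x (c -e k) j * W bs′ ((c -e k) -e j)) ∎

W-except : (b : Fin n) (bs : List (Fin n)) (c : Vec ℕ n) →
           W (b ∷ bs) c + sgn (lookup c b) * W bs (c -e b) ≡ ∑[ j < n ] (sgn (lookup c j) * W bs (c -e j))
W-except {n} b bs c = trans
  (cong (_+ sgn (lookup c b) * W bs (c -e b)) (sum-cong-≗ {n} (λ j → unless-*ʳ (b ≟ᶠ j))))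
  (∑-except b (λ j → sgn (lookup c j) * W bs (c -e j)))

weight-empty : (b : Fin n) (c : Vec ℕ n) (j : Fin n) → lookup c j ≡ 0 → weight b c j ≡ 0
weight-empty b c j cⱼ≡0 = trans (cong (λ a → unless (b ≟ᶠ j) (sgn a)) cⱼ≡0) (unless-0 (b ≟ᶠ j))

sgn-pos : ∀ {a} → 0 < a → (x : ℕ) → sgn a * x ≡ x
sgn-pos {suc a} _ x = *-identityˡ x

Deranged : (bl : A → Fin n) (bs : List (Fin n)) → Vec A (length bs) → Set
Deranged bl bs v = ∀ a → ¬ bl (lookup v a) ≡ L.lookup bs a

Deranged? : (bl : A → Fin n) (bs : List (Fin n)) → Decidable (Deranged bl bs)
Deranged? bl bs v = all? (λ a → ¬? (bl (lookup v a) ≟ᶠ L.lookup bs a))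

HasCounts : Vec ℕ n → Vec (Fin n) k → Set
HasCounts c w = ∀ j → cnt id (toList w) j ≡ lookup c j

HasCounts? : (c : Vec ℕ n) → Decidable (HasCounts {k = k} c)
HasCounts? c w = all? (λ j → cnt id (toList w) j ≟ lookup c j)

Words : List (Fin n) → Vec ℕ n → ℕ
Words {n} bs c = # (λ w → HasCounts? c w ×-dec Deranged? id bs w) (vecs (allFin n) (length bs))

cnt-∷-self : (j : Fin n) (l : List (Fin n)) → cnt id (j ∷ l) j ≡ suc (cnt id l j)
cnt-∷-self j l = trans (#-∷ (_≟ᶠ j) j l) (cong (_+ cnt id l j) (when-yes (j ≟ᶠ j) refl))

counts-∷⁻ : (c : Vec ℕ n) (j : Fin n) (w : Vec (Fin n) k) → HasCounts c (j ∷ w) → HasCounts (c -e j) w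
counts-∷⁻ c j w h = minus-e c j (λ i → trans (sym (#-∷ (_≟ᶠ i) j (toList w))) (h i))

counts-∷⁺ : (c : Vec ℕ n) (j : Fin n) → 0 < lookup c j → (w : Vec (Fin n) k) →
            HasCounts (c -e j) w → HasCounts c (j ∷ w)
counts-∷⁺ c j cⱼ>0 w h i = trans (#-∷ (_≟ᶠ i) j (toList w)) (plus-e c j cⱼ>0 h i)

words-first-letter : (b : Fin n) (bs : List (Fin n)) (c : Vec ℕ n) (j : Fin n) →
  # (λ w → HasCounts? c (j ∷ w) ×-dec Deranged? id (b ∷ bs) (j ∷ w)) (vecs (allFin n) (length bs))
    ≡ weight b c j * Words bs (c -e j)
words-first-letter {n} b bs c j with b ≟ᶠ j | lookup c j in cⱼ
... | yes b≡j | _ = #-none _ (λ _ (_ , d) → d zero (sym b≡j)) (vecs (allFin n) (length bs))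
... | no _ | zero = #-none _ (λ w (h , _) → 0≢1+n (trans (sym cⱼ) (trans (sym (h j)) (cnt-∷-self j (toList w))))) (vecs (allFin n) (length bs))
... | no b≢j | suc m = trans (#-≐ _ (λ w → HasCounts? (c -e j) w ×-dec Deranged? id bs w)
                                  (λ {w} (h , d) → counts-∷⁻ c j w h , d ∘ suc)
                                  (λ {w} (h , d) → counts-∷⁺ c j cⱼ>0 w h , avoid d)
                                  (vecs (allFin n) (length bs)))
                             (sym (+-identityʳ _))
  where
  cⱼ>0 : 0 < lookup c j
  cⱼ>0 rewrite cⱼ = s≤s z≤n
  avoid : ∀ {w} → Deranged id bs w → Deranged id (b ∷ bs) (j ∷ w)
  avoid d zero    = b≢j ∘ sym
  avoid d (suc a) = d a

words≡W : (bs : List (Fin n)) (c : Vec ℕ n) → Words bs c ≡ W bs c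
words≡W {n} [] c = trans (#-vecs-zero (λ w → HasCounts? c w ×-dec Deranged? id [] w) (allFin n))
  (when-⇔ (HasCounts? c [] ×-dec Deranged? id [] []) (all? (λ j → lookup c j ≟ 0))
          (λ (h , _) j → sym (h j)) (λ c≡0 → (λ j → sym (c≡0 j)) , λ ()))
words≡W {n} (b ∷ bs) c = begin
  Words (b ∷ bs) c
    ≡⟨ #-vecs-suc (λ w → HasCounts? c w ×-dec Deranged? id (b ∷ bs) w) (allFin n) ⟩
  sumOver (allFin n) starting-with
    ≡⟨ sumOver-allFin starting-with ⟩
  ∑[ j < n ] starting-with j
    ≡⟨ sum-cong-≗ {n} (λ j → trans (words-first-letter b bs c j) (cong (weight b c j *_) (words≡W bs (c -e j)))) ⟩
  W (b ∷ bs) c ∎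
  where
  open ≡-Reasoning
  starting-with : Fin n → ℕ
  starting-with j = # (λ w → HasCounts? c (j ∷ w) ×-dec Deranged? id (b ∷ bs) (j ∷ w)) (vecs (allFin n) (length bs))

unique-vec? : Decidable (λ (v : Vec (Fin N) k) → Unique (toList v))
unique-vec? v = UniqueDec.unique? _≟ᶠ_ (toList v)

Placements : (Fin N → Fin n) → List (Fin n) → List (Fin N) → ℕ
Placements bl bs xs = # (λ v → Deranged? bl bs v ×-dec unique-vec? v) (vecs xs (length bs))

placements-extend : (bl : Fin N → Fin n) (b : Fin n) (bs : List (Fin n)) (xs : List (Fin N)) (x : Fin N) →
  # (λ v → Deranged? bl (b ∷ bs) (x ∷ v) ×-dec unique-vec? (x ∷ v)) (vecs xs (length bs))
    ≡ unless (b ≟ᶠ bl x) (Placements bl bs (remove x xs))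
placements-extend bl b bs xs x with b ≟ᶠ bl x
... | yes b≡blx = #-none _ (λ _ (d , _) → d zero (sym b≡blx)) (vecs xs (length bs))
... | no b≢blx = trans
  (#-≐ _ (λ v → All.all? (λ y → ¬? (x ≟ᶠ y)) (toList v) ×-dec (Deranged? bl bs v ×-dec unique-vec? v))
       (λ (d , x∷v!) → AllPairs.head x∷v! , d ∘ suc , AllPairs.tail x∷v!)
       (λ (x∉v , d , v!) → extend d , x∉v ∷ v!)
       (vecs xs (length bs)))
  (#-vecs-restrict (λ y → ¬? (x ≟ᶠ y)) xs (length bs) (λ v → Deranged? bl bs v ×-dec unique-vec? v))
  where
  extend : ∀ {v} → Deranged bl bs v → Deranged bl (b ∷ bs) (x ∷ v)
  extend d zero    = b≢blx ∘ sym
  extend d (suc a) = d a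

factorials-first : (c : Vec ℕ n) (b j : Fin n) (w : ℕ) →
  lookup c j * unless (b ≟ᶠ j) (prodFact (c -e j) * w) ≡ prodFact c * (weight b c j * w)
factorials-first c b j w with b ≟ᶠ j | lookup c j in cⱼ
... | yes _ | cⱼ′  = trans (*-zeroʳ cⱼ′) (sym (*-zeroʳ (prodFact c)))
... | no _ | zero  = sym (*-zeroʳ (prodFact c))
... | no _ | suc m = begin
  suc m * (prodFact (c -e j) * w) ≡⟨ *-assoc (suc m) (prodFact (c -e j)) w ⟨
  suc m * prodFact (c -e j) * w   ≡⟨ cong (_* w) (prodFact-−e c j cⱼ) ⟨
  prodFact c * w                  ≡⟨ cong (prodFact c *_) (+-identityʳ w) ⟨
  prodFact c * (1 * w)            ∎
  where open ≡-Reasoning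

PlacementsFormula : (Fin N → Fin n) → List (Fin n) → Set
PlacementsFormula bl bs = ∀ xs c → Unique xs → length xs ≡ length bs → (∀ j → cnt bl xs j ≡ lookup c j) →
                          Placements bl bs xs ≡ prodFact c * W bs c

placements-rest : (bl : Fin N → Fin n) (bs : List (Fin n)) → PlacementsFormula bl bs →
  (xs : List (Fin N)) (c : Vec ℕ n) → Unique xs → length xs ≡ suc (length bs) → (∀ j → cnt bl xs j ≡ lookup c j) →
  ∀ {x} → x ∈ xs → Placements bl bs (remove x xs) ≡ prodFact (c -e bl x) * W bs (c -e bl x)
placements-rest bl bs formula xs c xs! |xs| counts {x} x∈xs = formula (remove x xs) (c -e bl x) (remove-unique xs!)
  (suc-injective (trans (length-remove xs! x∈xs) |xs|))
  (minus-e c (bl x) (λ i → trans (+-comm (when (bl x ≟ᶠ i) 1) _) (trans (cnt-remove bl i xs! x∈xs) (counts i))))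

placements-first : (bl : Fin N → Fin n) (b : Fin n) (bs : List (Fin n)) → PlacementsFormula bl bs →
  (xs : List (Fin N)) (c : Vec ℕ n) → Unique xs → length xs ≡ suc (length bs) → (∀ j → cnt bl xs j ≡ lookup c j) →
  (j : Fin n) →
  # (λ v → (bl (lookup v zero) ≟ᶠ j) ×-dec (Deranged? bl (b ∷ bs) v ×-dec unique-vec? v)) (vecs xs (suc (length bs)))
    ≡ prodFact c * (weight b c j * W bs (c -e j))
placements-first {n = n} bl b bs formula xs c xs! |xs| counts j = begin
  # (λ v → (bl (lookup v zero) ≟ᶠ j) ×-dec (Deranged? bl (b ∷ bs) v ×-dec unique-vec? v)) (vecs xs (suc (length bs)))
    ≡⟨ #-vecs-suc _ xs ⟩
  sumOver xs (λ x → # (λ v → (bl x ≟ᶠ j) ×-dec (Deranged? bl (b ∷ bs) (x ∷ v) ×-dec unique-vec? (x ∷ v))) (vecs xs (length bs)))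
    ≡⟨ sumOver-cong xs (λ {x} _ → trans (#-const (bl x ≟ᶠ j) _ (vecs xs (length bs)))
                                        (cong (when (bl x ≟ᶠ j)) (placements-extend bl b bs xs x))) ⟩
  sumOver xs (λ x → when (bl x ≟ᶠ j) (unless (b ≟ᶠ bl x) (Placements bl bs (remove x xs))))
    ≡⟨ sumOver-cong xs (λ {x} x∈xs → trans (cong (λ p → when (bl x ≟ᶠ j) (unless (b ≟ᶠ bl x) p)) (placements-rest bl bs formula xs c xs! |xs| counts x∈xs))
                                            (in-block (bl x ≟ᶠ j))) ⟩
  sumOver xs (λ x → when (bl x ≟ᶠ j) (after j))
    ≡⟨ sumOver-block bl j (after j) xs ⟩
  cnt bl xs j * after j
    ≡⟨ cong (_* after j) (counts j) ⟩
  lookup c j * after j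
    ≡⟨ factorials-first c b j (W bs (c -e j)) ⟩
  prodFact c * (weight b c j * W bs (c -e j)) ∎
  where
  open ≡-Reasoning
  after : Fin n → ℕ
  after i = unless (b ≟ᶠ i) (prodFact (c -e i) * W bs (c -e i))
  in-block : ∀ {i} (d : Dec (i ≡ j)) → when d (after i) ≡ when d (after j)
  in-block (yes refl) = refl
  in-block (no _)     = refl

-- The formula holds for every bs, by induction: split the placements of b ∷ bs
-- by the block of their first entry.
placements : (bl : Fin N → Fin n) (bs : List (Fin n)) → PlacementsFormula bl bs
placements {N = N} bl [] [] c _ _ counts = begin
  when (Deranged? bl [] [] ×-dec unique-vec? {N = N} []) 1 ≡⟨ when-yes (Deranged? bl [] [] ×-dec unique-vec? {N = N} []) ((λ ()) , []) ⟩
  1                                               ≡⟨ cong₂ _*_ (prodFact-zeros c c≡0) (when-yes (all? (λ j → lookup c j ≟ 0)) c≡0) ⟨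
  prodFact c * W [] c                             ∎
  where
  open ≡-Reasoning
  c≡0 : ∀ j → lookup c j ≡ 0
  c≡0 j = sym (counts j)
placements {n = n} bl (b ∷ bs) xs c xs! |xs| counts = begin
  Placements bl (b ∷ bs) xs
    ≡⟨ #-by-block _ (λ v → bl (lookup v zero)) (vecs xs (suc (length bs))) ⟩
  ∑[ j < n ] # (λ v → (bl (lookup v zero) ≟ᶠ j) ×-dec (Deranged? bl (b ∷ bs) v ×-dec unique-vec? v)) (vecs xs (suc (length bs)))
    ≡⟨ sum-cong-≗ {n} (placements-first bl b bs (placements bl bs) xs c xs! |xs| counts) ⟩
  ∑[ j < n ] (prodFact c * (weight b c j * W bs (c -e j)))
    ≡⟨ *-distribˡ-sum (prodFact c) (λ j → weight b c j * W bs (c -e j)) ⟨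
  prodFact c * W (b ∷ bs) c ∎
  where open ≡-Reasoning

realize : (bl : Fin N → Fin n) (xs : List (Fin N)) (w : Vec (Fin n) k) →
          Unique xs → length xs ≡ k → (∀ j → cnt id (toList w) j ≡ cnt bl xs j) →
          Σ[ v ∈ Vec (Fin N) k ] All (_∈ xs) (toList v) × Unique (toList v) × w ≡ Data.Vec.map bl v
realize bl xs []       _   _     _      = [] , [] , [] , refl
realize bl xs (j ∷ w) xs! |xs| counts
  with #-pos (λ x → bl x ≟ᶠ j) xs (subst (0 <_) (trans (sym (cnt-∷-self j (toList w))) (counts j)) (s≤s z≤n))
... | x , x∈xs , refl
  with realize bl (remove x xs) w (remove-unique xs!) (suc-injective (trans (length-remove xs! x∈xs) |xs|)) counts′
  where
  counts′ : ∀ i → cnt id (toList w) i ≡ cnt bl (remove x xs) i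
  counts′ i = +-cancelˡ-≡ (when (bl x ≟ᶠ i) 1) _ _ (begin
    when (bl x ≟ᶠ i) 1 + cnt id (toList w) i ≡⟨ #-∷ (_≟ᶠ i) (bl x) (toList w) ⟨
    cnt id (toList (bl x ∷ w)) i              ≡⟨ counts i ⟩
    cnt bl xs i                               ≡⟨ cnt-remove bl i xs! x∈xs ⟨
    cnt bl (remove x xs) i + when (bl x ≟ᶠ i) 1 ≡⟨ +-comm (cnt bl (remove x xs) i) _ ⟩
    when (bl x ≟ᶠ i) 1 + cnt bl (remove x xs) i ∎)
    where open ≡-Reasoning
... | v , v⊆ , v! , w≡v = x ∷ v , (x∈xs ∷ All.map (proj₁ ∘ ∈-filter⁻ (λ y → ¬? (x ≟ᶠ y)) {xs = xs}) v⊆)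
                                 , (All.map (proj₂ ∘ ∈-filter⁻ (λ y → ¬? (x ≟ᶠ y)) {xs = xs}) v⊆ ∷ v!) , cong (bl x ∷_) w≡v

cnt-word : (t : Vec ℕ n) (j : Fin n) → cnt id (word t) j ≡ lookup t j
cnt-word (k ∷ t) zero = begin
  cnt id (L.replicate k zero ++ map suc (word t)) zero
    ≡⟨ #-++ (_≟ᶠ zero) (L.replicate k zero) (map suc (word t)) ⟩
  cnt id (L.replicate k zero) zero + cnt id (map suc (word t)) zero
    ≡⟨ cong₂ _+_ (#-replicate (_≟ᶠ zero) zero k)
                 (trans (#-map (_≟ᶠ zero) suc (word t)) (#-none (λ x → suc x ≟ᶠ zero) (λ _ ()) (word t))) ⟩
  k + 0
    ≡⟨ +-identityʳ k ⟩
  k ∎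
  where open ≡-Reasoning
cnt-word (k ∷ t) (suc j) = begin
  cnt id (L.replicate k zero ++ map suc (word t)) (suc j)
    ≡⟨ #-++ (_≟ᶠ suc j) (L.replicate k zero) (map suc (word t)) ⟩
  cnt id (L.replicate k zero) (suc j) + cnt id (map suc (word t)) (suc j)
    ≡⟨ cong₂ _+_ (#-replicate (_≟ᶠ suc j) zero k) (#-map (_≟ᶠ suc j) suc (word t)) ⟩
  # (λ x → suc x ≟ᶠ suc j) (word t)
    ≡⟨ #-≐ (λ x → suc x ≟ᶠ suc j) (_≟ᶠ j) fin-suc-injective (cong suc) (word t) ⟩
  cnt id (word t) j
    ≡⟨ cnt-word t j ⟩
  lookup t j ∎
  where open ≡-Reasoning

cnt-positions : (l : List (Fin n)) (j : Fin n) → cnt (L.lookup l) (allFin (length l)) j ≡ cnt id l j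
cnt-positions l j = begin
  cnt (L.lookup l) (allFin (length l)) j       ≡⟨ #-map (_≟ᶠ j) (L.lookup l) (allFin (length l)) ⟨
  cnt id (map (L.lookup l) (allFin (length l))) j ≡⟨ cong (λ l′ → cnt id l′ j) (trans (LP.map-tabulate id (L.lookup l)) (LP.tabulate-lookup l)) ⟩
  cnt id l j                                    ∎
  where open ≡-Reasoning

block-counts : (t : Vec ℕ n) (j : Fin n) → cnt (block t) (allFin (size t)) j ≡ lookup t j
block-counts t j = trans (cnt-positions (word t) j) (cnt-word t j)

length-allFin : (N : ℕ) → length (allFin N) ≡ N
length-allFin N = LP.length-tabulate {n = N} id

word-perm : (s : Vec ℕ n) (j : Fin n) → 0 < lookup s j → word s ↭ j ∷ word (s -e j)
word-perm (suc a ∷ s) zero    _ = ↭-refl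
word-perm (a ∷ s)     (suc j) p = ↭-trans (Perm.++⁺ˡ (L.replicate a zero) (Perm.map⁺ suc (word-perm s j p)))
                                          (Perm.shift (suc j) (L.replicate a zero) (map suc (word (s -e j))))

word-zeros : ∀ m → word (replicate m 0) ≡ []
word-zeros zero    = refl
word-zeros (suc m) = cong (map suc) (word-zeros m)

rearrangement⇒counts : (t : Vec ℕ n) (w : Vec (Fin n) (size t)) →
  Any (λ σ → w ≡ tabulate (λ a → block t (lookup σ a))) (perms (size t)) → HasCounts t w
rearrangement⇒counts t w rearr j with find rearr
... | σ , σ∈perms , w≡σ = begin
  cnt id (toList w) j                            ≡⟨ cong (λ u → cnt id (toList u) j) w≡blσ ⟩
  cnt id (toList (Data.Vec.map (block t) σ)) j    ≡⟨ cong (λ l → cnt id l j) (VP.toList-map (block t) σ) ⟩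
  cnt id (map (block t) (toList σ)) j             ≡⟨ #-map (_≟ᶠ j) (block t) (toList σ) ⟩
  cnt (block t) (toList σ) j                      ≡⟨ cnt-full (block t) j (toList σ) σ! (All.universal ∈-allFin _) (UP.allFin⁺ (size t)) |σ| ⟩
  cnt (block t) (allFin (size t)) j                      ≡⟨ block-counts t j ⟩
  lookup t j                                      ∎
  where
  open ≡-Reasoning
  σ! : Unique (toList σ)
  σ! = proj₂ (∈-filter⁻ unique-vec? {xs = vecs (allFin (size t)) (size t)} σ∈perms)
  |σ| : length (toList σ) ≡ length (allFin (size t))
  |σ| = trans (VP.length-toList σ) (sym (length-allFin (size t)))
  w≡blσ : w ≡ Data.Vec.map (block t) σ
  w≡blσ = trans w≡σ (trans (VP.tabulate-∘ (block t) (lookup σ)) (cong (Data.Vec.map (block t)) (VP.tabulate∘lookup σ)))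

counts⇒rearrangement : (t : Vec ℕ n) (w : Vec (Fin n) (size t)) → HasCounts t w →
  Any (λ σ → w ≡ tabulate (λ a → block t (lookup σ a))) (perms (size t))
counts⇒rearrangement t w counts
  with realize (block t) (allFin (size t)) w (UP.allFin⁺ (size t)) (length-allFin (size t))
               (λ j → trans (counts j) (sym (block-counts t j)))
... | σ , σ⊆ , σ! , w≡blσ =
  lose (∈-filter⁺ unique-vec? (vecs-complete (allFin (size t)) σ σ⊆) σ!)
       (trans w≡blσ (sym (trans (VP.tabulate-∘ (block t) (lookup σ)) (cong (Data.Vec.map (block t)) (VP.tabulate∘lookup σ)))))

P′≡W : (t : Vec ℕ n) → P′ t ≡ W (word t) t
P′≡W {n} t = trans
  (#-≐ _ (λ w → HasCounts? t w ×-dec Deranged? id (word t) w)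
       (λ {w} (r , d) → rearrangement⇒counts t w r , d)
       (λ {w} (h , d) → counts⇒rearrangement t w h , d)
       (vecs (allFin n) (size t)))
  (words≡W (word t) t)

P≡W : (t : Vec ℕ n) → P t ≡ prodFact t * W (word t) t
P≡W t = trans (cong length (filter-filter (Deranged? (block t) (word t)) unique-vec? (vecs (allFin (size t)) (size t))))
  (placements (block t) (word t) (allFin (size t)) t (UP.allFin⁺ (size t)) (length-allFin (size t)) (block-counts t))

g-unfold : (i : Fin (suc m)) (k : ℕ) (t : Vec ℕ m) →
  g i (suc k ∷ t) ≡ # (λ σ → block (suc k ∷ t) (lookup σ zero) ≟ᶠ i) (GDs (suc k ∷ t))
g-unfold zero    k t = refl
g-unfold (suc i) k t = refl

g≡W : (i : Fin (suc m)) (k : ℕ) (t : Vec ℕ m) →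
  g i (suc k ∷ t) ≡ prodFact (suc k ∷ t) * (weight zero (suc k ∷ t) i * W (word (k ∷ t)) ((suc k ∷ t) -e i))
g≡W {m} i k t = begin
  g i c
    ≡⟨ g-unfold i k t ⟩
  # (λ σ → block c (lookup σ zero) ≟ᶠ i) (GDs c)
    ≡⟨ cong (# (λ σ → block c (lookup σ zero) ≟ᶠ i)) (filter-filter (Deranged? (block c) (word c)) unique-vec? (vecs (allFin (size c)) (size c))) ⟩
  # (λ σ → block c (lookup σ zero) ≟ᶠ i) (filter (λ σ → Deranged? (block c) (word c) σ ×-dec unique-vec? σ) (vecs (allFin (size c)) (size c)))
    ≡⟨ cong length (filter-filter (λ σ → block c (lookup σ zero) ≟ᶠ i) (λ σ → Deranged? (block c) (word c) σ ×-dec unique-vec? σ) (vecs (allFin (size c)) (size c))) ⟩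
  # (λ σ → (block c (lookup σ zero) ≟ᶠ i) ×-dec (Deranged? (block c) (word c) σ ×-dec unique-vec? σ)) (vecs (allFin (size c)) (size c))
    ≡⟨ placements-first (block c) zero (word (k ∷ t)) (placements (block c) (word (k ∷ t)))
                        (allFin (size c)) c (UP.allFin⁺ (size c)) (length-allFin (size c)) (block-counts c) i ⟩
  prodFact c * (weight zero c i * W (word (k ∷ t)) (c -e i)) ∎
  where
  open ≡-Reasoning
  c : Vec ℕ (suc m)
  c = suc k ∷ t

exact-div : (t : Vec ℕ n) (X : ℕ) {a : ℕ} → a ≡ prodFact t * X → _/_ a (prodFact t) {{prodFact-nz t}} ≡ X
exact-div t X refl = trans (cong (λ a → _/_ a (prodFact t) {{prodFact-nz t}}) (*-comm (prodFact t) X))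
                           (m*n/n≡m X (prodFact t) {{prodFact-nz t}})

g′≡W : (i : Fin (suc m)) (k : ℕ) (t : Vec ℕ m) →
  g′ i (suc k ∷ t) ≡ weight zero (suc k ∷ t) i * W (word (k ∷ t)) ((suc k ∷ t) -e i)
g′≡W i k t = exact-div (suc k ∷ t) _ (g≡W i k t)

part-a : (t : Vec ℕ (suc m)) → head t ≡ 0 → g′ zero t ≡ P′ t × (∀ i → i ≢ zero → g′ i t ≡ 0)
part-a (zero ∷ t) _ = trans (exact-div (zero ∷ t) _ (P≡W (zero ∷ t))) (sym (P′≡W (zero ∷ t))) , other
  where
  other : ∀ i → i ≢ zero → g′ i (zero ∷ t) ≡ 0
  other zero    i≢0 = ⊥-elim (i≢0 refl)
  other (suc i) _   = exact-div (zero ∷ t) 0 (sym (*-zeroʳ (prodFact (zero ∷ t))))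

part-a-zeros : ∀ m → g′ zero (replicate (suc m) 0) ≡ 1
part-a-zeros m = begin
  g′ zero zeros          ≡⟨ proj₁ (part-a zeros refl) ⟩
  P′ zeros               ≡⟨ P′≡W zeros ⟩
  W (word zeros) zeros   ≡⟨ cong (λ l → W l zeros) (word-zeros (suc m)) ⟩
  W [] zeros             ≡⟨ when-yes (all? (λ j → lookup zeros j ≟ 0)) (λ j → VP.lookup-replicate j 0) ⟩
  1                      ∎
  where
  open ≡-Reasoning
  zeros : Vec ℕ (suc m)
  zeros = replicate (suc m) 0

part-b : (t : Vec ℕ (suc m)) → 0 < head t → g′ zero t ≡ 0 × (∀ i → lookup t i ≡ 0 → g′ i t ≡ 0)
part-b (suc k ∷ t) _ = g′≡W zero k t , λ i tᵢ≡0 →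
  trans (g′≡W i k t) (cong (_* W (word (k ∷ t)) ((suc k ∷ t) -e i)) (weight-empty zero (suc k ∷ t) i tᵢ≡0))

-- Part (c): compare the recursions for W at t - e_i starting with the letters i and 1.
part-c : (t : Vec ℕ (suc m)) (i : Fin (suc m)) → 0 < head t → i ≢ zero → 0 < lookup t i →
         g′ i t ≡ P′ ((t -e zero) -e i) + P′ (t -e i) ∸ g′ i (t -e i)
part-c (suc k ∷ t) zero    _ i≢0 _ = ⊥-elim (i≢0 refl)
part-c {m} (suc k ∷ t) (suc i) _ _ tᵢ>0 = begin
  g′ (suc i) (suc k ∷ t)                       ≡⟨ g′≡W (suc i) k t ⟩
  sgn (lookup t i) * W (word (k ∷ t)) c′        ≡⟨ sgn-pos tᵢ>0 _ ⟩
  W (word (k ∷ t)) c′                          ≡⟨ W-perm (word-perm (k ∷ t) (suc i) tᵢ>0) c′ ⟩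
  W (suc i ∷ rest) c′                          ≡⟨ m+n∸n≡m _ (u (suc i)) ⟨
  W (suc i ∷ rest) c′ + u (suc i) ∸ u (suc i)   ≡⟨ cong (_∸ u (suc i)) split ⟩
  u zero + W (zero ∷ rest) c′ ∸ u (suc i)       ≡⟨ cong₂ (λ x y → x + y ∸ u (suc i)) u₀ (sym (P′≡W c′)) ⟩
  P′ (k ∷ (t -e i)) + P′ c′ ∸ u (suc i)         ≡⟨ cong (P′ (k ∷ (t -e i)) + P′ c′ ∸_) (g′≡W (suc i) k (t -e i)) ⟨
  P′ (k ∷ (t -e i)) + P′ c′ ∸ g′ (suc i) c′     ∎
  where
  open ≡-Reasoning
  c′ : Vec ℕ (suc m)
  c′ = suc k ∷ (t -e i)
  rest : List (Fin (suc m))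
  rest = word (k ∷ (t -e i))
  u : Fin (suc m) → ℕ
  u j = sgn (lookup c′ j) * W rest (c′ -e j)
  split : W (suc i ∷ rest) c′ + u (suc i) ≡ u zero + W (zero ∷ rest) c′
  split = trans (W-except (suc i) rest c′) (trans (sym (W-except zero rest c′)) (+-comm _ (u zero)))
  u₀ : u zero ≡ P′ (k ∷ (t -e i))
  u₀ = trans (*-identityˡ _) (sym (P′≡W (k ∷ (t -e i))))

-- Part (d): the g′_i are the terms of the recursion for P′.
part-d : (t : Vec ℕ (suc m)) → P′ t ≡ sum (tabulate (λ i → g′ i t))
part-d {m} (zero ∷ t) = sym (begin
  sum (tabulate (λ i → g′ i (zero ∷ t)))            ≡⟨ sum-tabulate (λ i → g′ i (zero ∷ t)) ⟩
  g′ zero (zero ∷ t) + ∑[ i < m ] g′ (suc i) (zero ∷ t)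
    ≡⟨ cong₂ _+_ (proj₁ (part-a (zero ∷ t) refl)) (∑-zero _ (λ i → proj₂ (part-a (zero ∷ t) refl) (suc i) λ ())) ⟩
  P′ (zero ∷ t) + 0                                 ≡⟨ +-identityʳ _ ⟩
  P′ (zero ∷ t)                                     ∎)
  where open ≡-Reasoning
part-d {m} (suc k ∷ t) = sym (begin
  sum (tabulate (λ i → g′ i (suc k ∷ t)))            ≡⟨ sum-tabulate (λ i → g′ i (suc k ∷ t)) ⟩
  ∑[ i < suc m ] g′ i (suc k ∷ t)                    ≡⟨ sum-cong-≗ {suc m} (λ i → g′≡W i k t) ⟩
  W (word (suc k ∷ t)) (suc k ∷ t)                  ≡⟨ P′≡W (suc k ∷ t) ⟨
  P′ (suc k ∷ t)                                    ∎)
  where open ≡-Reasoning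

theorem3p2 : ∀ {m} (t : Vec ℕ (suc m)) →
      ((head t ≡ 0 → g′ zero t ≡ P′ t × (∀ i → i ≢ zero → g′ i t ≡ 0))
    × g′ zero (replicate (suc m) 0) ≡ 1)
    × (0 < head t → g′ zero t ≡ 0 × (∀ i → lookup t i ≡ 0 → g′ i t ≡ 0))
    × (∀ i → 0 < head t → i ≢ zero → 0 < lookup t i →
         g′ i t ≡ P′ ((t -e zero) -e i) + P′ (t -e i) ∸ g′ i (t -e i))
    × P′ t ≡ sum (tabulate (λ i → g′ i t))
theorem3p2 {m} t = (part-a t , part-a-zeros m) , part-b t , part-c t , part-d t
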